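{- Let $(X,\nu,\mathcal{T}_1,\tau_1)$ and $(Y,\mu,\mathcal{T}_2,\tau_2)$ be Type 1 computable topological spaces, and let $f:X\to Y$ be $(\nu,\mu)$-computable. (1) If $X$ satisfies the Markov condition with respect to effective sequential closure, i.e. $\forall x\in X,\forall A\subseteq X,\ (x\notin A\ \&\ x\in\overline{A}^{+\mathrm{seq}})\implies A\rightsquigarrow_\nu\{x\}$, then $f$ has no effective sequential discontinuity: there is no $x\in X$ and effective open $O_2$ of $Y$ with $x\in f^{ -1}(O_2)\cap\overline{(f^{ -1}(O_2))^c}^{+\mathrm{seq}}$. (2) If $X$ satisfies the Markov condition with respect to normed effective sequential closure, i.e. $\forall x\in X,\forall A\subseteq X,\ (x\notin A\ \&\ x\in\overline{A}^{+\mathrm{seq},N})\implies A\rightsquigarrow_\nu\{x\}$, then $f$ has no normed effective sequential discontinuity: there is no $x\in X$ and effective open $O_2$ of $Y$ with $x\in f^{ -1}(O_2)\cap\overline{(f^{ -1}(O_2))^c}^{+\mathrm{seq},N}$.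
   Context: A numbering of a set $X$ is a surjection $\nu$ from a subset $\mathrm{dom}(\nu)\subseteq\mathbb{N}$ onto $X$; a subnumbering of $X$ is a numbering of a subset of $X$. $\varphi_0,\varphi_1,\dots$ is a standard enumeration of the partial recursive functions. For numbered sets $(X,\nu),(Y,\mu)$, a map $f:X\to Y$ is $(\nu,\mu)$-computable if there is a partial computable $F$ defined on $\mathrm{dom}(\nu)$ with $\mu(F(n))=f(\nu(n))$ for all $n\in\mathrm{dom}(\nu)$. A set $A\subseteq X$ is $\nu$-semi-decidable if there is $e$ with $\varphi_e(i)\downarrow\iff\nu(i)\in A$ for all $i\in\mathrm{dom}(\nu)$; such $e$ is a $\nu_{SD}$-name of $A$. For $B\subseteq C\subseteq X$, $B$ is a $\nu$-semi-decidable subset of $C$ if there is $e$ such that for all $i\in\mathrm{dom}(\nu)$ with $\nu(i)\in C$: $\varphi_e(i)\downarrow\iff\nu(i)\in B$. One writes $A\rightsquigarrow_\nu B$ iff $B$ is not a $\nu$-semi-decidable subset of $A\cup B$. For subnumberings $\alpha,\beta$ of a set, $\alpha\le\beta$ means there is a partial computable $F$ defined on $\mathrm{dom}(\alpha)$ with $\beta(F(n))=\alpha(n)$. A sequence $(u_n)$ in $X$ is $\nu$-computable if there is a total computable $g$ with $g(n)\in\mathrm{dom}(\nu)$ and $\nu(g(n))=u_n$ for all $n$. A Type 1 computable topological space is a quadruple $(X,\nu,\mathcal{T},\tau)$ where $\mathcal{T}$ is a topology on $X$, $\nu$ a numbering of $X$, $\tau$ a subnumbering of $\mathcal{T}$,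 such that: the image of $\tau$ generates $\mathcal{T}$ as a basis; $\emptyset$ and $X$ are in the image of $\tau$; $\tau\le\nu_{SD}$; there is a computable procedure which, given an index of a total computable $g$ with values in $\mathrm{dom}(\tau)$, outputs a $\tau$-name of $\bigcup_n\tau(g(n))$; and there is a computable procedure which from $\tau$-names of $O_1,O_2$ outputs a $\tau$-name of $O_1\cap O_2$. Sets in the image of $\tau$ are the effective open sets. $S^c$ is the complement in $X$. For $A\subseteq X$, $\overline{A}^{+\mathrm{seq}}$ is the set of limits (in $\mathcal{T}_1$) of converging $\nu$-computable sequences of elements of $A$. A $\nu$-computable sequence $(u_n)$ converging to $x$ is computably normed if there is a partial computable function which, on input any $\tau_1$-name of an open set $O$ containing $x$, outputs $N$ with $u_n\in O$ for all $n\ge N$; $\overline{A}^{+\mathrm{seq},N}$ is the set of limits of computably normed converging $\nu$-computable sequences of elements of $A$. -}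

module Defs where

open import Level using (0ℓ)
open import Data.Nat using (ℕ; zero; suc; _+_; _<_; _≥_)
open import Data.Nat.DivMod using (_%_; _/_)
open import Data.Product using (Σ; ∃; _×_; _,_; proj₁; proj₂)
open import Data.Empty using (⊥)
open import Relation.Nullary using (¬_)
open import Relation.Unary using (Pred; _∈_; _∉_; _∪_; _∩_; _≐_; _⊆_; ∅; U; ｛_｝; _⟨→⟩_)
open import Relation.Binary.PropositionalEquality using (_≡_)
open import Function.Bundles using (_⇔_)

-- Cantor pairing (a bijection ℕ × ℕ ≅ ℕ)

tri : ℕ → ℕ
tri zero    = zero
tri (suc d) = suc d + tri d

pair : ℕ → ℕ → ℕ
pair a b = tri (a + b) + a

-- inverse of pair, by walking the diagonals
unpair : ℕ → ℕ × ℕ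
unpair zero = 0 , 0
unpair (suc n) with unpair n
... | a , zero  = 0 , suc a
... | a , suc b = suc a , b

-- Partial recursive functions ℕ ⇀ ℕ (Kleene-style, unary with pairing)

data Code : Set where
  Zc Sc Ic Fst Snd : Code
  Pair Comp Prim   : Code → Code → Code
  Mu               : Code → Code

data _⊢_↦_ : Code → ℕ → ℕ → Set where
  ev-Z    : ∀ {x} → Zc ⊢ x ↦ 0
  ev-S    : ∀ {x} → Sc ⊢ x ↦ suc x
  ev-I    : ∀ {x} → Ic ⊢ x ↦ x
  ev-Fst  : ∀ {x} → Fst ⊢ x ↦ proj₁ (unpair x)
  ev-Snd  : ∀ {x} → Snd ⊢ x ↦ proj₂ (unpair x)
  ev-Pair : ∀ {f g x a b} → f ⊢ x ↦ a → g ⊢ x ↦ b → Pair f g ⊢ x ↦ pair a b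
  ev-Comp : ∀ {f g x y z} → g ⊢ x ↦ y → f ⊢ y ↦ z → Comp f g ⊢ x ↦ z
  ev-Prim0 : ∀ {f g x y} → f ⊢ x ↦ y → Prim f g ⊢ pair x 0 ↦ y
  ev-PrimS : ∀ {f g x n r y} → Prim f g ⊢ pair x n ↦ r →
             g ⊢ pair (pair x n) r ↦ y → Prim f g ⊢ pair x (suc n) ↦ y
  ev-Mu   : ∀ {f x n} → f ⊢ pair x n ↦ 0 →
            (∀ m → m < n → ∃ λ k → f ⊢ pair x m ↦ suc k) → Mu f ⊢ x ↦ n

-- Gödel numbering of codes (surjective decoding ℕ → Code)
build : ℕ → Code → Code → Code
build 0 a b = Zc
build 1 a b = Sc
build 2 a b = Ic
build 3 a b = Fst
build 4 a b = Snd
build 5 a b = Pair a b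
build 6 a b = Comp a b
build 7 a b = Prim a b
build _ a b = Mu a

decodeF : ℕ → ℕ → Code
decodeF zero    n = Zc
decodeF (suc k) n =
  build (n % 9) (decodeF k (proj₁ (unpair (n / 9)))) (decodeF k (proj₂ (unpair (n / 9))))

decode : ℕ → Code
decode n = decodeF n n

φ_⟨_⟩↦_ : ℕ → ℕ → ℕ → Set
φ e ⟨ i ⟩↦ y = decode e ⊢ i ↦ y

_⟨_⟩↓ : ℕ → ℕ → Set
e ⟨ i ⟩↓ = ∃ λ y → φ e ⟨ i ⟩↦ y

-- Numberings.  A (sub)numbering of X is given by its domain dom ⊆ ℕ and a
-- value map on the domain, which must not depend on the domain proof.

record Numbering (X : Set) : Set₁ where
  field
    dom    : Pred ℕ 0ℓ
    val    : (n : ℕ) → dom n → X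
    val-irr : ∀ n (p q : dom n) → val n p ≡ val n q
    surj   : ∀ x → ∃ λ n → Σ (dom n) λ p → val n p ≡ x
open Numbering public

IsSDName : {X : Set} → Numbering X → ℕ → Pred X 0ℓ → Set
IsSDName ν e A = ∀ i (p : dom ν i) → (e ⟨ i ⟩↓ ⇔ A (val ν i p))

SDSubsetOf : {X : Set} → Numbering X → Pred X 0ℓ → Pred X 0ℓ → Set
SDSubsetOf ν B C = ∃ λ e → ∀ i (p : dom ν i) → C (val ν i p) → (e ⟨ i ⟩↓ ⇔ B (val ν i p))

_⇝[_]_ : {X : Set} → Pred X 0ℓ → Numbering X → Pred X 0ℓ → Set
A ⇝[ ν ] B = ¬ SDSubsetOf ν B (A ∪ B)

IsComputable : {X Y : Set} → Numbering X → Numbering Y → (X → Y) → Set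
IsComputable ν μ f = ∃ λ c → ∀ n (p : dom ν n) →
  ∃ λ m → φ c ⟨ n ⟩↦ m × Σ (dom μ m) λ q → val μ m q ≡ f (val ν n p)

record CompTopSpace : Set₁ where
  field
    X      : Set
    ν      : Numbering X
    𝒯      : Pred (Pred X 0ℓ) 0ℓ
    domτ   : Pred ℕ 0ℓ
    τ      : (n : ℕ) → domτ n → Pred X 0ℓ
    τ-irr  : ∀ n (p q : domτ n) → τ n p ≐ τ n q
    τ-open : ∀ n (p : domτ n) → 𝒯 (τ n p)
    basis  : ∀ (O : Pred X 0ℓ) →
             𝒯 O ⇔ (∀ x → O x → ∃ λ n → Σ (domτ n) λ p → τ n p x × τ n p ⊆ O)
    τ-∅    : ∃ λ n → Σ (domτ n) λ p → τ n p ≐ ∅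
    τ-X    : ∃ λ n → Σ (domτ n) λ p → τ n p ≐ U
    τ≤SD   : ∃ λ c → ∀ n (p : domτ n) →
             ∃ λ m → φ c ⟨ n ⟩↦ m × IsSDName ν m (τ n p)
    τ-⋃    : ∃ λ c → ∀ e → (∀ n → ∃ λ k → φ e ⟨ n ⟩↦ k × domτ k) →
             ∃ λ m → φ c ⟨ e ⟩↦ m × Σ (domτ m) λ q →
               τ m q ≐ (λ x → ∃ λ n → ∃ λ k → φ e ⟨ n ⟩↦ k × Σ (domτ k) λ r → τ k r x)
    τ-∩    : ∃ λ c → ∀ a b (pa : domτ a) (pb : domτ b) →
             ∃ λ m → φ c ⟨ pair a b ⟩↦ m × Σ (domτ m) λ q → τ m q ≐ (τ a pa ∩ τ b pb)

  IsNuComputableSeq : (ℕ → X) → Set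
  IsNuComputableSeq u = ∃ λ c → ∀ n → ∃ λ k → φ c ⟨ n ⟩↦ k × Σ (dom ν k) λ p → val ν k p ≡ u n

  ConvergesTo : (ℕ → X) → X → Set₁
  ConvergesTo u x = ∀ O → 𝒯 O → O x → ∃ λ N → ∀ n → n ≥ N → O (u n)

  ComputablyNormed : (ℕ → X) → X → Set
  ComputablyNormed u x = ∃ λ c → ∀ k (p : domτ k) → τ k p x →
    ∃ λ N → φ c ⟨ k ⟩↦ N × (∀ n → n ≥ N → τ k p (u n))

  SeqClosure : Pred X 0ℓ → X → Set₁
  SeqClosure A x = ∃ λ (u : ℕ → X) → IsNuComputableSeq u × (∀ n → A (u n)) × ConvergesTo u x

  NormedSeqClosure : Pred X 0ℓ → X → Set₁
  NormedSeqClosure A x = ∃ λ (u : ℕ → X) → IsNuComputableSeq u × (∀ n → A (u n)) ×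
                          ConvergesTo u x × ComputablyNormed u x

  MarkovSeq : Set₁
  MarkovSeq = ∀ (x : X) (A : Pred X 0ℓ) → x ∉ A → SeqClosure A x → A ⇝[ ν ] ｛ x ｝

  MarkovNormedSeq : Set₁
  MarkovNormedSeq = ∀ (x : X) (A : Pred X 0ℓ) → x ∉ A → NormedSeqClosure A x → A ⇝[ ν ] ｛ x ｝

open CompTopSpace public

_⁻¹[_] : {X Y : Set} → (X → Y) → Pred Y 0ℓ → Pred X 0ℓ
f ⁻¹[ O ] = λ x → O (f x)

compl : {X : Set} → Pred X 0ℓ → Pred X 0ℓ
compl A = λ x → ¬ A x

HasEffSeqDiscontinuity : (S₁ S₂ : CompTopSpace) → (X S₁ → X S₂) → Set₁
HasEffSeqDiscontinuity S₁ S₂ f =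
  ∃ λ (x : X S₁) → ∃ λ k → Σ (domτ S₂ k) λ q →
    (f ⁻¹[ τ S₂ k q ]) x × SeqClosure S₁ (compl (f ⁻¹[ τ S₂ k q ])) x

HasNormedEffSeqDiscontinuity : (S₁ S₂ : CompTopSpace) → (X S₁ → X S₂) → Set₁
HasNormedEffSeqDiscontinuity S₁ S₂ f =
  ∃ λ (x : X S₁) → ∃ λ k → Σ (domτ S₂ k) λ q →
    (f ⁻¹[ τ S₂ k q ]) x × NormedSeqClosure S₁ (compl (f ⁻¹[ τ S₂ k q ])) x

-- Since f is computable and effective opens of Y are semi-decidable, the preimage
-- f⁻¹(O₂) is ν-semi-decidable. If x ∈ f⁻¹(O₂), then on (f⁻¹(O₂))ᶜ ∪ {x} membership in
-- f⁻¹(O₂) coincides with being x, so {x} is a semi-decidable subset of that set. The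
-- Markov condition applied to A = (f⁻¹(O₂))ᶜ says exactly that this is impossible
-- whenever x lies in the (normed) effective sequential closure of A.
module Submission where

open import Level using (0ℓ)
open import Data.Nat
open import Data.Nat.Properties
open import Data.Nat.DivMod
open import Data.Nat.Divisibility using (divides)
open import Data.Product using (Σ; ∃; _×_; _,_; proj₁; proj₂)
open import Data.Sum using (inj₁; inj₂)
open import Data.Empty using (⊥-elim)
open import Function.Bundles using (_⇔_; mk⇔; Equivalence)
open import Relation.Nullary using (¬_)
open import Relation.Unary using (Pred; _∈_; _∉_; _∪_; ｛_｝)
open import Relation.Binary.PropositionalEquality
open import Relation.Binary.Definitions using (tri<; tri≈; tri>)
open import Defs

open Equivalence using (to; from)

pair-suc-left : ∀ a b → pair (suc a) b ≡ suc (pair a (suc b))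
pair-suc-left a b rewrite +-suc a b = +-suc (tri (suc (a + b))) a

pair-zero-suc : ∀ b → pair 0 (suc b) ≡ suc (pair b 0)
pair-zero-suc b rewrite +-identityʳ b | +-identityʳ (b + tri b) = cong suc (+-comm b (tri b))

unpair-suc-from-row-end : ∀ n {a} → unpair n ≡ (a , 0) → unpair (suc n) ≡ (0 , suc a)
unpair-suc-from-row-end n eq with unpair n
unpair-suc-from-row-end n refl | _ = refl

unpair-suc-along-row : ∀ n {a b} → unpair n ≡ (a , suc b) → unpair (suc n) ≡ (suc a , b)
unpair-suc-along-row n eq with unpair n
unpair-suc-along-row n refl | _ = refl

unpair-pair-on-diagonal : ∀ s a b → a + b ≡ s → unpair (pair a b) ≡ (a , b)
unpair-pair-on-diagonal s zero zero _ = refl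
unpair-pair-on-diagonal zero zero (suc b) ()
unpair-pair-on-diagonal (suc s) zero (suc b) a+b≡s =
  trans (cong unpair (pair-zero-suc b))
        (unpair-suc-from-row-end (pair b 0)
          (unpair-pair-on-diagonal s b zero (trans (+-identityʳ b) (suc-injective a+b≡s))))
unpair-pair-on-diagonal s (suc a) b a+b≡s =
  trans (cong unpair (pair-suc-left a b))
        (unpair-suc-along-row (pair a (suc b))
          (unpair-pair-on-diagonal s a (suc b) (trans (+-suc a b) a+b≡s)))

unpair-pair : ∀ a b → unpair (pair a b) ≡ (a , b)
unpair-pair a b = unpair-pair-on-diagonal _ a b refl

pair-injective : ∀ a b c d → pair a b ≡ pair c d → a ≡ c × b ≡ d
pair-injective a b c d eq
  with trans (sym (unpair-pair a b)) (trans (cong unpair eq) (unpair-pair c d))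
... | refl = refl , refl

encode : Code → ℕ
encode Zc         = 0
encode Sc         = 1
encode Ic         = 2
encode Fst        = 3
encode Snd        = 4
encode (Pair a b) = 5 + pair (encode a) (encode b) * 9
encode (Comp a b) = 6 + pair (encode a) (encode b) * 9
encode (Prim a b) = 7 + pair (encode a) (encode b) * 9
encode (Mu a)     = 8 + pair (encode a) 0 * 9

%9-digit : ∀ {r} q → r < 9 → (r + q * 9) % 9 ≡ r
%9-digit {r} q r<9 = trans ([m+kn]%n≡m%n r q 9) (m<n⇒m%n≡m r<9)

/9-digit : ∀ {r} q → r < 9 → (r + q * 9) / 9 ≡ q
/9-digit {r} q r<9 =
  trans (+-distrib-/-∣ʳ r (divides q refl)) (cong₂ _+_ (m<n⇒m/n≡0 r<9) (m*n/n≡m q 9))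

decodeF-step : ∀ k r a b → r < 9 →
               decodeF (suc k) (r + pair a b * 9) ≡ build r (decodeF k a) (decodeF k b)
decodeF-step k r a b r<9
  rewrite %9-digit (pair a b) r<9 | /9-digit (pair a b) r<9 | unpair-pair a b = refl

pair-left≤ : ∀ a b → a ≤ pair a b
pair-left≤ a b = m≤n+m a (tri (a + b))

pair-right≤ : ∀ a b → b ≤ pair a b
pair-right≤ a b = ≤-trans (m≤n+m b a) (≤-trans (n≤tri (a + b)) (m≤m+n (tri (a + b)) a))
  where
  n≤tri : ∀ n → n ≤ tri n
  n≤tri zero    = z≤n
  n≤tri (suc n) = m≤m+n (suc n) (tri n)

≤-digit-expansion : ∀ r {m P k} → m ≤ P → r + P * 9 ≤ k → m ≤ k
≤-digit-expansion r {P = P} m≤P le =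
  ≤-trans m≤P (≤-trans (m≤m*n P 9) (≤-trans (m≤n+m (P * 9) r) le))

-- The fuel k suffices because unfolding one layer of an encoding r + P * 9 ≤ suc k
-- leaves fuel k ≥ P, which bounds both components of P.
decodeF-encode : ∀ c k → encode c ≤ k → decodeF k (encode c) ≡ c
decodeF-encode Zc  zero    _ = refl
decodeF-encode Zc  (suc k) _ = refl
decodeF-encode Sc  (suc k) _ = refl
decodeF-encode Ic  (suc k) _ = refl
decodeF-encode Fst (suc k) _ = refl
decodeF-encode Snd (suc k) _ = refl
decodeF-encode (Pair a b) (suc k) (s≤s le)
  rewrite decodeF-step k 5 (encode a) (encode b) (m≤m+n 6 3)
        | decodeF-encode a k (≤-digit-expansion 4 (pair-left≤ (encode a) (encode b)) le)
        | decodeF-encode b k (≤-digit-expansion 4 (pair-right≤ (encode a) (encode b)) le) = refl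
decodeF-encode (Comp a b) (suc k) (s≤s le)
  rewrite decodeF-step k 6 (encode a) (encode b) (m≤m+n 7 2)
        | decodeF-encode a k (≤-digit-expansion 5 (pair-left≤ (encode a) (encode b)) le)
        | decodeF-encode b k (≤-digit-expansion 5 (pair-right≤ (encode a) (encode b)) le) = refl
decodeF-encode (Prim a b) (suc k) (s≤s le)
  rewrite decodeF-step k 7 (encode a) (encode b) (m≤m+n 8 1)
        | decodeF-encode a k (≤-digit-expansion 6 (pair-left≤ (encode a) (encode b)) le)
        | decodeF-encode b k (≤-digit-expansion 6 (pair-right≤ (encode a) (encode b)) le) = refl
decodeF-encode (Mu a) (suc k) (s≤s le)
  rewrite decodeF-step k 8 (encode a) 0 (m≤m+n 9 0)
        | decodeF-encode a k (≤-digit-expansion 7 (pair-left≤ (encode a) 0) le) = refl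

decode-encode : ∀ c → decode (encode c) ≡ c
decode-encode c = decodeF-encode c (encode c) ≤-refl

-- Stated for merely equal inputs because Prim and Mu take inputs of the form pair x n,
-- which cannot be unified directly.
⊢-deterministic : ∀ {c x x′ y y′} → c ⊢ x ↦ y → c ⊢ x′ ↦ y′ → x ≡ x′ → y ≡ y′
⊢-deterministic ev-Z   ev-Z   _  = refl
⊢-deterministic ev-S   ev-S   eq = cong suc eq
⊢-deterministic ev-I   ev-I   eq = eq
⊢-deterministic ev-Fst ev-Fst eq = cong (λ z → proj₁ (unpair z)) eq
⊢-deterministic ev-Snd ev-Snd eq = cong (λ z → proj₂ (unpair z)) eq
⊢-deterministic (ev-Pair f g) (ev-Pair f′ g′) eq =
  cong₂ pair (⊢-deterministic f f′ eq) (⊢-deterministic g g′ eq)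
⊢-deterministic (ev-Comp g f) (ev-Comp g′ f′) eq =
  ⊢-deterministic f f′ (⊢-deterministic g g′ eq)
⊢-deterministic (ev-Prim0 {x = x} f) (ev-Prim0 {x = x′} f′) eq =
  ⊢-deterministic f f′ (proj₁ (pair-injective x 0 x′ 0 eq))
⊢-deterministic (ev-Prim0 {x = x} _) (ev-PrimS {x = x′} {n = n′} _ _) eq
  with () ← proj₂ (pair-injective x 0 x′ (suc n′) eq)
⊢-deterministic (ev-PrimS {x = x} {n = n} _ _) (ev-Prim0 {x = x′} _) eq
  with () ← proj₂ (pair-injective x (suc n) x′ 0 eq)
⊢-deterministic (ev-PrimS {x = x} {n = n} r g) (ev-PrimS {x = x′} {n = n′} r′ g′) eq =
  ⊢-deterministic g g′ (cong₂ pair same-arg (⊢-deterministic r r′ same-arg))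
  where
  same-arg : pair x n ≡ pair x′ n′
  same-arg = let x≡x′ , sn≡sn′ = pair-injective x (suc n) x′ (suc n′) eq
             in cong₂ pair x≡x′ (suc-injective sn≡sn′)
⊢-deterministic (ev-Mu {n = n} zero-at-n below-n) (ev-Mu {n = n′} zero-at-n′ below-n′) eq
  with <-cmp n n′
... | tri≈ _ n≡n′ _ = n≡n′
... | tri< n<n′ _ _ with () ← ⊢-deterministic zero-at-n (proj₂ (below-n′ n n<n′)) (cong₂ pair eq refl)
... | tri> _ _ n′<n with () ← ⊢-deterministic (proj₂ (below-n n′ n′<n)) zero-at-n′ (cong₂ pair eq refl)

_∘ᶜ_ : ℕ → ℕ → ℕ
d ∘ᶜ c = encode (Comp (decode d) (decode c))

φ-∘-intro : ∀ {d c i j y} → φ c ⟨ i ⟩↦ j → φ d ⟨ j ⟩↦ y → φ (d ∘ᶜ c) ⟨ i ⟩↦ y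
φ-∘-intro {i = i} {y = y} c↦j d↦y =
  subst (λ C → C ⊢ i ↦ y) (sym (decode-encode _)) (ev-Comp c↦j d↦y)

φ-∘-elim : ∀ d c {i y} → φ (d ∘ᶜ c) ⟨ i ⟩↦ y → ∃ λ j → φ c ⟨ i ⟩↦ j × φ d ⟨ j ⟩↦ y
φ-∘-elim d c {i} {y} run
  with subst (λ C → C ⊢ i ↦ y) (decode-encode (Comp (decode d) (decode c))) run
... | ev-Comp c↦j d↦y = _ , c↦j , d↦y

preimage-semiDecidable : ∀ {A B : Set} {ν : Numbering A} {μ : Numbering B} {f : A → B}
                           {O : Pred B 0ℓ} →
                         IsComputable ν μ f → ∃ (λ e → IsSDName μ e O) →
                         ∃ (λ e → IsSDName ν e (f ⁻¹[ O ]))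
preimage-semiDecidable {ν = ν} {μ} {f} {O} (c , f-comp) (e , e-name) = e ∘ᶜ c , name
  where
  name : IsSDName ν (e ∘ᶜ c) (f ⁻¹[ O ])
  name i p = mk⇔ halts⇒O O⇒halts
    where
    j = proj₁ (f-comp i p)
    c↦j = proj₁ (proj₂ (f-comp i p))
    e-at-j : e ⟨ j ⟩↓ ⇔ O (f (val ν i p))
    e-at-j = let q , q↦fx = proj₂ (proj₂ (f-comp i p)) in
             subst (λ y → e ⟨ j ⟩↓ ⇔ O y) q↦fx (e-name j q)

    halts⇒O : (e ∘ᶜ c) ⟨ i ⟩↓ → O (f (val ν i p))
    halts⇒O (y , run) =
      let j′ , c↦j′ , e↦y = φ-∘-elim e c run
      in to e-at-j (y , subst (λ k → φ e ⟨ k ⟩↦ y) (⊢-deterministic c↦j′ c↦j refl) e↦y)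

    O⇒halts : O (f (val ν i p)) → (e ∘ᶜ c) ⟨ i ⟩↓
    O⇒halts fx∈O = let y , e↦y = from e-at-j fx∈O in y , φ-∘-intro {e} {c} c↦j e↦y

-- On Uᶜ ∪ {x} with x ∈ U, membership in U holds exactly at x.
singleton-semiDecidableIn : ∀ {A : Set} {ν : Numbering A} {U : Pred A 0ℓ} {x : A} →
                            ∃ (λ e → IsSDName ν e U) → x ∈ U →
                            SDSubsetOf ν ｛ x ｝ (compl U ∪ ｛ x ｝)
singleton-semiDecidableIn {ν = ν} {U} {x} (e , e-name) x∈U = e , name
  where
  name : ∀ i (p : dom ν i) → (compl U ∪ ｛ x ｝) (val ν i p) → e ⟨ i ⟩↓ ⇔ (x ≡ val ν i p)
  name i p (inj₁ ∉U) = mk⇔ (λ halts → ⊥-elim (∉U (to (e-name i p) halts)))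
                           (λ x≡ → from (e-name i p) (subst U x≡ x∈U))
  name i p (inj₂ x≡) = mk⇔ (λ _ → x≡) (λ x≡′ → from (e-name i p) (subst U x≡′ x∈U))

effectiveOpen-semiDecidable : ∀ S k (q : domτ S k) → ∃ (λ e → IsSDName (ν S) e (τ S k q))
effectiveOpen-semiDecidable S k q =
  let _ , τ≤νSD = τ≤SD S
      e , _ , e-name = τ≤νSD k q
  in e , e-name

markov⇒noDiscontinuity : ∀ (S₁ S₂ : CompTopSpace) (f : X S₁ → X S₂) →
  IsComputable (ν S₁) (ν S₂) f → (Cl : Pred (X S₁) 0ℓ → X S₁ → Set₁) →
  (∀ x A → x ∉ A → Cl A x → A ⇝[ ν S₁ ] ｛ x ｝) →
  ¬ (∃ λ x → ∃ λ k → Σ (domτ S₂ k) λ q →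
       (f ⁻¹[ τ S₂ k q ]) x × Cl (compl (f ⁻¹[ τ S₂ k q ])) x)
markov⇒noDiscontinuity S₁ S₂ f f-comp Cl markov (x , k , q , fx∈O , x∈closure) =
  markov x (compl preimage) (λ x∉preimage → x∉preimage fx∈O) x∈closure x-isolated
  where
  preimage : Pred (X S₁) 0ℓ
  preimage = f ⁻¹[ τ S₂ k q ]

  preimage-SD : ∃ λ e → IsSDName (ν S₁) e preimage
  preimage-SD = preimage-semiDecidable {ν = ν S₁} {ν S₂} {f} {τ S₂ k q} f-comp
                  (effectiveOpen-semiDecidable S₂ k q)

  x-isolated : SDSubsetOf (ν S₁) ｛ x ｝ (compl preimage ∪ ｛ x ｝)
  x-isolated = singleton-semiDecidableIn {ν = ν S₁} {U = preimage} preimage-SD fx∈O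

mainTheorem6 : (S₁ S₂ : CompTopSpace) (f : X S₁ → X S₂) →
    IsComputable (ν S₁) (ν S₂) f →
    (MarkovSeq S₁ → ¬ HasEffSeqDiscontinuity S₁ S₂ f) ×
    (MarkovNormedSeq S₁ → ¬ HasNormedEffSeqDiscontinuity S₁ S₂ f)
mainTheorem6 S₁ S₂ f f-comp =
  markov⇒noDiscontinuity S₁ S₂ f f-comp (SeqClosure S₁) ,
  markov⇒noDiscontinuity S₁ S₂ f f-comp (NormedSeqClosure S₁)
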